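{- For all integers $m,q,k\ge 1$ and every positive divisor $d$ of $m$: (a) $|\mathcal{LC}^{(d)}(m,q,k)|=|\mathcal{LC}^{(1)}(m/d,q,k)|$; (b) for each $k$-mer $y\in\Omega^k$, $|\mathcal{LC}^{(d)}_y(m,q,k)|=|\mathcal{LC}^{(1)}_y(m/d,q,k)|$; (c) $|\mathcal{C}^{(d)}(m,q,k)|=|\mathcal{C}^{(1)}(m/d,q,k)|$.
   Context: Let $\Omega$ be a totally ordered alphabet of size $q\ge 1$; a $k$-mer is an element of $\Omega^k$. For $s=a_1\ldots a_n$ define $\rho(a_1\ldots a_n)=a_na_1\ldots a_{n-1}$; the cyclic sequence $(s)$ is the set of rotations $\{\rho^i(s)\}$, each a linearization of $(s)$. The number of occurrences of a $k$-mer $y$ in $(a_1\ldots a_n)$ is the number of $i\in\{1,\ldots,n\}$ with $a_i\cdots a_{i+k-1}=y$, indices modulo $n$ (positions may be reused if $k>n$). A cyclic multi de Bruijn sequence with parameters $(m,q,k)$ is a cyclic sequence over $\Omega$ in which every $k$-mer occurs exactly $m$ times. The order of a cyclic sequence $(s)$ (or of a linearization $s$) of length $n$ is the largest positive divisor $d$ of $n$ with $\rho^{n/d}(s)=s$. $\mathcal{C}^{(d)}(m,q,k)$ is the set of cyclic multi de Bruijn sequences with parameters $(m,q,k)$ of order $d$; $\mathcal{LC}^{(d)}(m,q,k)$ is the set of all linearizations of its elements, and $\mathcal{LC}^{(d)}_y(m,q,k)$ the subset of those starting with the $k$-mer $y$. -}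

module Defs where

open import Data.Nat using (ℕ; zero; suc; _+_; _*_; _^_; _≤ᵇ_; _≡ᵇ_; _⊔_; _<ᵇ_)
open import Data.Nat.DivMod using (_/_; _%_; _mod_)
open import Data.Bool using (Bool; true; false; _∧_; _∨_; not)
open import Data.Fin using (Fin; toℕ)
import Data.Fin as Fin
open import Data.Vec using (Vec; []; _∷_; lookup; tabulate; last; init)
import Data.Vec.Properties as VecP
open import Data.List using (List; []; _∷_; length; filterᵇ; upTo; map; concatMap; foldr)
open import Relation.Nullary.Decidable using (⌊_⌋)

allᵇ : ∀ {A : Set} → (A → Bool) → List A → Bool
allᵇ p = foldr (λ x b → p x ∧ b) true

Word : ℕ → ℕ → Set
Word q n = Vec (Fin q) n

allFinL : (q : ℕ) → List (Fin q)
allFinL zero = []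
allFinL (suc q) = Fin.zero ∷ map Fin.suc (allFinL q)

allWords : (q n : ℕ) → List (Word q n)
allWords q zero = [] ∷ []
allWords q (suc n) = concatMap (λ a → map (a ∷_) (allWords q n)) (allFinL q)

eqW : ∀ {q n} → Word q n → Word q n → Bool
eqW u v = ⌊ VecP.≡-dec Fin._≟_ u v ⌋

ρ : ∀ {q n} → Word q n → Word q n
ρ [] = []
ρ (x ∷ xs) = last (x ∷ xs) ∷ init (x ∷ xs)

ρ^ : ∀ {q n} → ℕ → Word q n → Word q n
ρ^ zero s = s
ρ^ (suc i) s = ρ (ρ^ i s)

-- The k-mer a_{i+1} … a_{i+k} of a nonempty word s (0-based start i), indices modulo n.
window : ∀ {q n} (k : ℕ) → Word q (suc n) → ℕ → Word q k
window {n = n} k s i = tabulate (λ j → lookup s ((i + toℕ j) mod (suc n)))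

count : ∀ {A : Set} → (A → Bool) → List A → ℕ
count p xs = length (filterᵇ p xs)

occ : ∀ {q n k} → Word q n → Word q k → ℕ
occ {n = zero} s y = 0
occ {n = suc n} {k} s y = count (λ i → eqW (window k s i) y) (upTo (suc n))

isMDB : ∀ {q n} (m k : ℕ) → Word q n → Bool
isMDB {q} m k s = allᵇ (λ y → occ s y ≡ᵇ m) (allWords q k)

divides? : ℕ → ℕ → Bool
divides? zero n = false
divides? (suc d) n = n % suc d ≡ᵇ 0

-- The order of s : the largest positive divisor d of n with ρ^{n/d}(s) = s.
-- (For n ≥ 1 such d exists, since d = 1 works; for n = 0 we return 0.)
order : ∀ {q n} → Word q n → ℕ
order {n = n} s = foldr _⊔_ 0 (map candidate (upTo n))
  where
  candidate : ℕ → ℕ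
  candidate e with divides? (suc e) n ∧ eqW (ρ^ (n / suc e) s) s
  ... | true  = suc e
  ... | false = 0

lexLeq : ∀ {q n} → Word q n → Word q n → Bool
lexLeq [] [] = true
lexLeq (x ∷ xs) (y ∷ ys) = (toℕ x <ᵇ toℕ y) ∨ ((toℕ x ≡ᵇ toℕ y) ∧ lexLeq xs ys)

isCanonical : ∀ {q n} → Word q n → Bool
isCanonical {n = n} s = allᵇ (λ i → lexLeq s (ρ^ i s)) (upTo n)

-- Every k-mer occurs m times forces length n = m * q^k, so linearizations of
-- elements of C(m,q,k) are exactly the words of length m * q^k with isMDB.
len : ℕ → ℕ → ℕ → ℕ
len m q k = m * q ^ k

inLC : ∀ {q} (d m k : ℕ) → Word q (len m q k) → Bool
inLC d m k s = isMDB m k s ∧ (order s ≡ᵇ d)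

#LC : (d m q k : ℕ) → ℕ
#LC d m q k = count (inLC d m k) (allWords q (len m q k))

-- The k-mer at the start of a linearization (cyclically read if k > n).
startsWith : ∀ {q n k} → Word q n → Word q k → Bool
startsWith {n = zero} s y = false
startsWith {n = suc n} {k} s y = eqW (window k s 0) y

#LCy : (d m q k : ℕ) → Word q k → ℕ
#LCy d m q k y = count (λ s → inLC d m k s ∧ startsWith s y) (allWords q (len m q k))

-- |C^(d)(m,q,k)| : cyclic sequences counted via their unique lexicographically
-- least rotation.
#C : (d m q k : ℕ) → ℕ
#C d m q k = count (λ s → inLC d m k s ∧ isCanonical s) (allWords q (len m q k))

module Submission where

-- Write D = d + 1.  The D-fold
-- repetition u ↦ uᴰ maps the words u of length n+1 with order 1 bijectively onto the
-- words of length D(n+1) with order D: a word of order D has the period n+1 and is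
-- therefore the repetition of its prefix, and by Bézout every period of a word of
-- order 1 is a multiple of its length, which pins down the order of uᴰ.  Repetition
-- multiplies every k-mer count by D and preserves both the first k-mer and being the
-- least rotation, so with n+1 = (m/D)·q^k all three counts of the lemma transfer.

open import Defs
open import Data.Nat using (ℕ; NonZero; _/_)
open import Data.Nat.Divisibility using (_∣_)
open import Data.Fin using (Fin)
open import Data.Product using (_×_)
open import Relation.Binary.PropositionalEquality using (_≡_)

open import Data.Nat using (zero; suc; pred; _+_; _*_; _^_; _∸_; _≤_; _<_; _⊔_; _≡ᵇ_; _<ᵇ_; _<?_; s≤s; s≤s⁻¹)
open import Data.Nat.Properties
open import Data.Nat.DivMod using (_%_; _mod_; m%n<n; m<n⇒m%n≡m; [m+n]%n≡m%n; [m+kn]%n≡m%n; %-distribˡ-+; m%n%n≡m%n; m*n/n≡m; m*[n/m]≡n; m≡m%n+[m/n]*n; m∣n⇒o%n%m≡o%m)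
open import Data.Nat.Divisibility using (divides; divides-refl; ∣⇒≤; m%n≡0⇒n∣m; n∣m⇒m%n≡0)
open import Data.Nat.GCD using (gcd; gcd-GCD; gcd[m,n]∣m; gcd[m,n]∣n; module Bézout)
open import Data.Nat.Solver using (module +-*-Solver)
open +-*-Solver using (solve; _:=_; _:+_; _:*_; con)
open import Data.Bool using (Bool; true; false; _∧_; _∨_; T)
open import Data.Bool.Properties using (∧-assoc; ∧-idem; ∧-identityʳ; ∨-zeroʳ)
open import Data.Fin using (toℕ)
import Data.Fin as F
import Data.Fin.Properties as FP
open import Data.Vec using ([]; _∷_; lookup; tabulate; _++_)
import Data.Vec as V
import Data.Vec.Properties as VP
open import Data.List as L using (List; []; _∷_; map; foldr; upTo; applyUpTo; concatMap)
open import Data.List.Properties using (map-upTo)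
open import Data.List.Membership.Propositional using (_∈_)
open import Data.List.Membership.Propositional.Properties using (∈-upTo⁺)
open import Data.List.Relation.Unary.Any using (here; there)
open import Data.Product using (Σ; _,_)
open import Data.Sum using (inj₁; inj₂)
open import Data.Unit using (tt)
open import Data.Empty using (⊥-elim)
open import Function using (_∘_; _∋_; id; it)
open import Relation.Nullary using (¬_; yes; no)
open import Relation.Binary.PropositionalEquality using (_≢_; refl; sym; trans; cong; cong₂; subst; module ≡-Reasoning)

∧-elimˡ : ∀ {a b} → (a ∧ b) ≡ true → a ≡ true
∧-elimˡ {true} _ = refl

∧-elimʳ : ∀ {a b} → (a ∧ b) ≡ true → b ≡ true
∧-elimʳ {true} h = h

∧-intro : ∀ {a b} → a ≡ true → b ≡ true → (a ∧ b) ≡ true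
∧-intro refl refl = refl

¬true⇒false : ∀ {b} → ¬ (b ≡ true) → b ≡ false
¬true⇒false {true} h = ⊥-elim (h refl)
¬true⇒false {false} _ = refl

bool-ext : ∀ {b c} → (b ≡ true → c ≡ true) → (c ≡ true → b ≡ true) → b ≡ c
bool-ext {true} {true} _ _ = refl
bool-ext {true} {false} f _ = sym (f refl)
bool-ext {false} {true} _ g = g refl
bool-ext {false} {false} _ _ = refl

≡ᵇ-sound : ∀ {m n} → (m ≡ᵇ n) ≡ true → m ≡ n
≡ᵇ-sound {m} {n} h = ≡ᵇ⇒≡ m n (subst T (sym h) tt)

≡ᵇ-refl : ∀ m → (m ≡ᵇ m) ≡ true
≡ᵇ-refl zero = refl
≡ᵇ-refl (suc m) = ≡ᵇ-refl m

≡ᵇ-cong-iff : ∀ {m n m' n'} → (m ≡ n → m' ≡ n') → (m' ≡ n' → m ≡ n) → (m ≡ᵇ n) ≡ (m' ≡ᵇ n')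
≡ᵇ-cong-iff {m} {n} {m'} {n'} f g =
  bool-ext (λ h → subst (λ z → (m' ≡ᵇ z) ≡ true) (f (≡ᵇ-sound h)) (≡ᵇ-refl m'))
           (λ h → subst (λ z → (m ≡ᵇ z) ≡ true) (g (≡ᵇ-sound h)) (≡ᵇ-refl m))

indicator : Bool → ℕ
indicator true = 1
indicator false = 0

sumBy : ∀ {A : Set} → (A → ℕ) → List A → ℕ
sumBy f [] = 0
sumBy f (x ∷ xs) = f x + sumBy f xs

count-∷ : ∀ {A : Set} (p : A → Bool) x xs → count p (x ∷ xs) ≡ indicator (p x) + count p xs
count-∷ p x xs with p x
... | true = refl
... | false = refl

count≡sumBy : ∀ {A : Set} (p : A → Bool) xs → count p xs ≡ sumBy (λ x → indicator (p x)) xs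
count≡sumBy p [] = refl
count≡sumBy p (x ∷ xs) = trans (count-∷ p x xs) (cong (indicator (p x) +_) (count≡sumBy p xs))

sumBy-cong : ∀ {A : Set} {f g : A → ℕ} → (∀ x → f x ≡ g x) → ∀ xs → sumBy f xs ≡ sumBy g xs
sumBy-cong h [] = refl
sumBy-cong h (x ∷ xs) = cong₂ _+_ (h x) (sumBy-cong h xs)

sumBy-++ : ∀ {A : Set} (f : A → ℕ) xs ys → sumBy f (xs L.++ ys) ≡ sumBy f xs + sumBy f ys
sumBy-++ f [] ys = refl
sumBy-++ f (x ∷ xs) ys = trans (cong (f x +_) (sumBy-++ f xs ys)) (sym (+-assoc (f x) _ _))

sumBy-map : ∀ {A B : Set} (f : B → ℕ) (g : A → B) xs → sumBy f (map g xs) ≡ sumBy (λ x → f (g x)) xs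
sumBy-map f g [] = refl
sumBy-map f g (x ∷ xs) = cong (f (g x) +_) (sumBy-map f g xs)

sumBy-concatMap : ∀ {A B : Set} (f : B → ℕ) (g : A → List B) xs →
                  sumBy f (concatMap g xs) ≡ sumBy (λ x → sumBy f (g x)) xs
sumBy-concatMap f g [] = refl
sumBy-concatMap f g (x ∷ xs) =
  trans (sumBy-++ f (g x) (concatMap g xs)) (cong (sumBy f (g x) +_) (sumBy-concatMap f g xs))

count-cong : ∀ {A : Set} {p p' : A → Bool} → (∀ x → p x ≡ p' x) → ∀ xs → count p xs ≡ count p' xs
count-cong {p = p} {p'} h xs =
  trans (count≡sumBy p xs) (trans (sumBy-cong (λ x → cong indicator (h x)) xs) (sym (count≡sumBy p' xs)))

count-++ : ∀ {A : Set} (p : A → Bool) xs ys → count p (xs L.++ ys) ≡ count p xs + count p ys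
count-++ p xs ys = begin
  count p (xs L.++ ys)                       ≡⟨ count≡sumBy p (xs L.++ ys) ⟩
  sumBy (indicator ∘ p) (xs L.++ ys)       ≡⟨ sumBy-++ _ xs ys ⟩
  sumBy (indicator ∘ p) xs + sumBy _ ys    ≡⟨ sym (cong₂ _+_ (count≡sumBy p xs) (count≡sumBy p ys)) ⟩
  count p xs + count p ys                    ∎
  where open ≡-Reasoning

count-map : ∀ {A B : Set} (p : B → Bool) (g : A → B) xs → count p (map g xs) ≡ count (p ∘ g) xs
count-map p g xs = trans (count≡sumBy p (map g xs)) (trans (sumBy-map _ g xs) (sym (count≡sumBy (p ∘ g) xs)))

count-none : ∀ {A : Set} (p : A → Bool) → (∀ x → p x ≡ false) → ∀ xs → count p xs ≡ 0
count-none p h [] = refl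
count-none p h (x ∷ xs) rewrite h x = count-none p h xs

false-off-witness : ∀ {A : Set} (p : A → Bool) {x₀} → (∀ x → p x ≡ true → x ≡ x₀) → ∀ {x} → x ≢ x₀ → p x ≡ false
false-off-witness p unique x≢x₀ = ¬true⇒false (λ px → x≢x₀ (unique _ px))

count-unique-Fin : ∀ {n} (p : Fin n → Bool) x₀ → (∀ x → p x ≡ true → x ≡ x₀) →
                   count p (allFinL n) ≡ indicator (p x₀)
count-unique-Fin {suc n} p F.zero unique = begin
  count p (F.zero ∷ map F.suc all)              ≡⟨ count-∷ p F.zero _ ⟩
  indicator (p F.zero) + count p (map F.suc all) ≡⟨ cong (indicator (p F.zero) +_) (count-map p F.suc all) ⟩
  indicator (p F.zero) + count (p ∘ F.suc) all  ≡⟨ cong (indicator (p F.zero) +_) (count-none (p ∘ F.suc) (λ x → false-off-witness p unique (λ ())) all) ⟩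
  indicator (p F.zero) + 0                      ≡⟨ +-identityʳ _ ⟩
  indicator (p F.zero)                          ∎
  where
  open ≡-Reasoning
  all = allFinL n
count-unique-Fin {suc n} p (F.suc x₀) unique = begin
  count p (F.zero ∷ map F.suc all)              ≡⟨ count-∷ p F.zero _ ⟩
  indicator (p F.zero) + count p (map F.suc all) ≡⟨ cong₂ _+_ (cong indicator (false-off-witness p unique (λ ()))) (count-map p F.suc all) ⟩
  count (p ∘ F.suc) all                         ≡⟨ count-unique-Fin (p ∘ F.suc) x₀ (λ x px → FP.suc-injective (unique (F.suc x) px)) ⟩
  indicator (p (F.suc x₀))                      ∎
  where
  open ≡-Reasoning
  all = allFinL n

module _ {q : ℕ} where

  count-allWords-suc : ∀ r (P : Word q (suc r) → Bool) →
    count P (allWords q (suc r)) ≡ sumBy (λ a → count (λ w → P (a ∷ w)) (allWords q r)) (allFinL q)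
  count-allWords-suc r P = begin
    count P (allWords q (suc r))
      ≡⟨ count≡sumBy P (allWords q (suc r)) ⟩
    sumBy (indicator ∘ P) (concatMap (λ a → map (a ∷_) (allWords q r)) (allFinL q))
      ≡⟨ sumBy-concatMap _ _ (allFinL q) ⟩
    sumBy (λ a → sumBy (indicator ∘ P) (map (a ∷_) (allWords q r))) (allFinL q)
      ≡⟨ sumBy-cong (λ a → trans (sym (count≡sumBy P (map (a ∷_) (allWords q r)))) (count-map P (a ∷_) (allWords q r))) (allFinL q) ⟩
    sumBy (λ a → count (λ w → P (a ∷ w)) (allWords q r)) (allFinL q)
      ∎
    where open ≡-Reasoning

  count-allWords-++ : ∀ a b (P : Word q (a + b) → Bool) →
    count P (allWords q (a + b)) ≡ sumBy (λ u → count (λ v → P (u ++ v)) (allWords q b)) (allWords q a)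
  count-allWords-++ zero b P = sym (+-identityʳ _)
  count-allWords-++ (suc a) b P = begin
    count P (allWords q (suc a + b))
      ≡⟨ count-allWords-suc (a + b) P ⟩
    sumBy (λ x → count (λ w → P (x ∷ w)) (allWords q (a + b))) (allFinL q)
      ≡⟨ sumBy-cong (λ x → count-allWords-++ a b (λ w → P (x ∷ w))) (allFinL q) ⟩
    sumBy (λ x → sumBy (λ u → G (x ∷ u)) (allWords q a)) (allFinL q)
      ≡⟨ sumBy-cong (λ x → sym (sumBy-map G (x ∷_) (allWords q a))) (allFinL q) ⟩
    sumBy (λ x → sumBy G (map (x ∷_) (allWords q a))) (allFinL q)
      ≡⟨ sym (sumBy-concatMap G _ (allFinL q)) ⟩
    sumBy G (allWords q (suc a))
      ∎
    where
    open ≡-Reasoning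
    G : Word q (suc a) → ℕ
    G u = count (λ v → P (u ++ v)) (allWords q b)

  count-unique : ∀ r (P : Word q r → Bool) w₀ → (∀ w → P w ≡ true → w ≡ w₀) →
                 count P (allWords q r) ≡ indicator (P w₀)
  count-unique zero P [] _ = trans (count-∷ P [] []) (+-identityʳ _)
  count-unique (suc r) P (x₀ ∷ w₀) unique = begin
    count P (allWords q (suc r))
      ≡⟨ count-allWords-suc r P ⟩
    sumBy (λ a → count (λ w → P (a ∷ w)) (allWords q r)) (allFinL q)
      ≡⟨ sumBy-cong (λ a → count-unique r (λ w → P (a ∷ w)) w₀ (λ w h → VP.∷-injectiveʳ (unique (a ∷ w) h))) (allFinL q) ⟩
    sumBy (λ a → indicator (P (a ∷ w₀))) (allFinL q)
      ≡⟨ sym (count≡sumBy (λ a → P (a ∷ w₀)) (allFinL q)) ⟩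
    count (λ a → P (a ∷ w₀)) (allFinL q)
      ≡⟨ count-unique-Fin (λ a → P (a ∷ w₀)) x₀ (λ a h → VP.∷-injectiveˡ (unique (a ∷ w₀) h)) ⟩
    indicator (P (x₀ ∷ w₀))
      ∎
    where open ≡-Reasoning

upTo-+ : ∀ a c → upTo (a + c) ≡ upTo a L.++ map (a +_) (upTo c)
upTo-+ a c = trans (applyUpTo-+ id a c) (cong (upTo a L.++_) (sym (map-upTo (a +_) c)))
  where
  applyUpTo-+ : ∀ {A : Set} (f : ℕ → A) a c → applyUpTo f (a + c) ≡ applyUpTo f a L.++ applyUpTo (λ i → f (a + i)) c
  applyUpTo-+ f zero c = refl
  applyUpTo-+ f (suc a) c = cong (f 0 ∷_) (applyUpTo-+ (f ∘ suc) a c)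

count-periodic : ∀ (g : ℕ → Bool) p → (∀ i → g (p + i) ≡ g i) → ∀ c → count g (upTo (c * p)) ≡ c * count g (upTo p)
count-periodic g p per zero = refl
count-periodic g p per (suc c) = begin
  count g (upTo (p + c * p))                               ≡⟨ cong (count g) (upTo-+ p (c * p)) ⟩
  count g (upTo p L.++ map (p +_) (upTo (c * p)))          ≡⟨ count-++ g (upTo p) _ ⟩
  count g (upTo p) + count g (map (p +_) (upTo (c * p)))   ≡⟨ cong (count g (upTo p) +_) (count-map g (p +_) (upTo (c * p))) ⟩
  count g (upTo p) + count (g ∘ (p +_)) (upTo (c * p))     ≡⟨ cong (count g (upTo p) +_) (count-cong per (upTo (c * p))) ⟩
  count g (upTo p) + count g (upTo (c * p))                ≡⟨ cong (count g (upTo p) +_) (count-periodic g p per c) ⟩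
  count g (upTo p) + c * count g (upTo p)                  ∎
  where open ≡-Reasoning

allᵇ-cong : ∀ {A : Set} {p p' : A → Bool} → (∀ x → p x ≡ p' x) → ∀ xs → allᵇ p xs ≡ allᵇ p' xs
allᵇ-cong h [] = refl
allᵇ-cong h (x ∷ xs) = cong₂ _∧_ (h x) (allᵇ-cong h xs)

allᵇ-++ : ∀ {A : Set} (p : A → Bool) xs ys → allᵇ p (xs L.++ ys) ≡ allᵇ p xs ∧ allᵇ p ys
allᵇ-++ p [] ys = refl
allᵇ-++ p (x ∷ xs) ys = trans (cong (p x ∧_) (allᵇ-++ p xs ys)) (sym (∧-assoc (p x) _ _))

allᵇ-map : ∀ {A B : Set} (p : B → Bool) (g : A → B) xs → allᵇ p (map g xs) ≡ allᵇ (p ∘ g) xs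
allᵇ-map p g [] = refl
allᵇ-map p g (x ∷ xs) = cong (p (g x) ∧_) (allᵇ-map p g xs)

all-periodic : ∀ (g : ℕ → Bool) p → (∀ i → g (p + i) ≡ g i) → ∀ c → allᵇ g (upTo (suc c * p)) ≡ allᵇ g (upTo p)
all-periodic g p per zero = cong (λ l → allᵇ g (upTo l)) (+-identityʳ p)
all-periodic g p per (suc c) = begin
  allᵇ g (upTo (p + suc c * p))                               ≡⟨ cong (allᵇ g) (upTo-+ p (suc c * p)) ⟩
  allᵇ g (upTo p L.++ map (p +_) (upTo (suc c * p)))          ≡⟨ allᵇ-++ g (upTo p) _ ⟩
  allᵇ g (upTo p) ∧ allᵇ g (map (p +_) (upTo (suc c * p)))    ≡⟨ cong (allᵇ g (upTo p) ∧_) (allᵇ-map g (p +_) (upTo (suc c * p))) ⟩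
  allᵇ g (upTo p) ∧ allᵇ (g ∘ (p +_)) (upTo (suc c * p))      ≡⟨ cong (allᵇ g (upTo p) ∧_) (allᵇ-cong per (upTo (suc c * p))) ⟩
  allᵇ g (upTo p) ∧ allᵇ g (upTo (suc c * p))                 ≡⟨ cong (allᵇ g (upTo p) ∧_) (all-periodic g p per c) ⟩
  allᵇ g (upTo p) ∧ allᵇ g (upTo p)                           ≡⟨ ∧-idem _ ⟩
  allᵇ g (upTo p)                                             ∎
  where open ≡-Reasoning

module _ {q : ℕ} where

  eqW-sound : ∀ {n} (u v : Word q n) → eqW u v ≡ true → u ≡ v
  eqW-sound u v h with VP.≡-dec FP._≟_ u v
  ... | yes u≡v = u≡v

  eqW-refl : ∀ {n} (u : Word q n) → eqW u u ≡ true
  eqW-refl u with VP.≡-dec FP._≟_ u u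
  ... | yes _ = refl
  ... | no u≢u = ⊥-elim (u≢u refl)

  ρ^-+ : ∀ {n} i j (s : Word q n) → ρ^ (i + j) s ≡ ρ^ i (ρ^ j s)
  ρ^-+ zero j s = refl
  ρ^-+ (suc i) j s = cong ρ (ρ^-+ i j s)

  lexLeq-refl : ∀ {n} (u : Word q n) → lexLeq u u ≡ true
  lexLeq-refl [] = refl
  lexLeq-refl (x ∷ xs) rewrite ≡ᵇ-refl (toℕ x) | lexLeq-refl xs = ∨-zeroʳ _

  lexLeq-++ : ∀ {n m} (u v : Word q n) (x y : Word q m) → (u ≡ v → x ≡ y) → lexLeq (u V.++ x) (v V.++ y) ≡ lexLeq u v
  lexLeq-++ [] [] x y tails rewrite tails refl = lexLeq-refl y
  lexLeq-++ (a ∷ u) (b ∷ v) x y tails with toℕ a ≡ᵇ toℕ b in a≡b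
  ... | false = refl
  ... | true = cong ((toℕ a <ᵇ toℕ b) ∨_)
                 (lexLeq-++ u v x y (λ u≡v → tails (cong₂ _∷_ (FP.toℕ-injective (≡ᵇ-sound a≡b)) u≡v)))

[m%n+c]%n≡[m+c]%n : ∀ m c n .{{_ : NonZero n}} → (m % n + c) % n ≡ (m + c) % n
[m%n+c]%n≡[m+c]%n m c n = begin
  (m % n + c) % n              ≡⟨ %-distribˡ-+ (m % n) c n ⟩
  (m % n % n + c % n) % n      ≡⟨ cong (λ z → (z + c % n) % n) (m%n%n≡m%n m n) ⟩
  (m % n + c % n) % n          ≡⟨ %-distribˡ-+ m c n ⟨
  (m + c) % n                  ∎
  where open ≡-Reasoning

module _ {q : ℕ} where

  at : ∀ {a} → Word q (suc a) → ℕ → Fin q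
  at {a} s x = lookup s (x mod suc a)

  at-cong : ∀ {a} (s : Word q (suc a)) x y → x % suc a ≡ y % suc a → at s x ≡ at s y
  at-cong {a} s x y h = cong (lookup s) (FP.toℕ-injective (begin
    toℕ (x mod suc a)  ≡⟨ FP.toℕ-fromℕ< (m%n<n x (suc a)) ⟩
    x % suc a          ≡⟨ h ⟩
    y % suc a          ≡⟨ FP.toℕ-fromℕ< (m%n<n y (suc a)) ⟨
    toℕ (y mod suc a)  ∎))
    where open ≡-Reasoning

  at-toℕ : ∀ {a} (s : Word q (suc a)) i → at s (toℕ i) ≡ lookup s i
  at-toℕ {a} s i = cong (lookup s) (FP.toℕ-injective
    (trans (FP.toℕ-fromℕ< (m%n<n (toℕ i) (suc a))) (m<n⇒m%n≡m (FP.toℕ<n i))))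

  word-ext : ∀ {a} (s s' : Word q (suc a)) → (∀ x → at s x ≡ at s' x) → s ≡ s'
  word-ext s s' h = begin
    s                        ≡⟨ VP.tabulate∘lookup s ⟨
    tabulate (lookup s)      ≡⟨ VP.tabulate-cong (λ i → trans (sym (at-toℕ s i)) (trans (h (toℕ i)) (at-toℕ s' i))) ⟩
    tabulate (lookup s')     ≡⟨ VP.tabulate∘lookup s' ⟩
    s'                       ∎
    where open ≡-Reasoning

  -- ρ s has the last letter of s in front: its i-th letter is the letter of s at i - 1 ≡ i + a.
  lookup-ρ : ∀ {a} (s : Word q (suc a)) (i : Fin (suc a)) → lookup (ρ s) i ≡ at s (toℕ i + a)
  lookup-ρ {a} s@(_ ∷ _) F.zero = trans (last≡lookup s) (trans (sym (at-toℕ s (F.fromℕ a))) (cong (at s) (FP.toℕ-fromℕ a)))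
    where
    last≡lookup : ∀ {b} (v : Word q (suc b)) → V.last v ≡ lookup v (F.fromℕ b)
    last≡lookup {zero} (y ∷ []) = refl
    last≡lookup {suc b} (y ∷ ys) = last≡lookup ys
  lookup-ρ {a} s@(_ ∷ _) (F.suc j) = begin
    lookup (V.init s) j                  ≡⟨ lookup-init s j ⟩
    lookup s (F.inject₁ j)               ≡⟨ at-toℕ s (F.inject₁ j) ⟨
    at s (toℕ (F.inject₁ j))             ≡⟨ cong (at s) (FP.toℕ-inject₁ j) ⟩
    at s (toℕ j)                         ≡⟨ at-cong s (toℕ j) (toℕ j + suc a) (sym ([m+n]%n≡m%n (toℕ j) (suc a))) ⟩
    at s (toℕ j + suc a)                 ≡⟨ cong (at s) (+-suc (toℕ j) a) ⟩
    at s (suc (toℕ j) + a)               ∎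
    where
    open ≡-Reasoning
    lookup-init : ∀ {b} (v : Word q (suc b)) (k : Fin b) → lookup (V.init v) k ≡ lookup v (F.inject₁ k)
    lookup-init {suc b} (y ∷ ys) F.zero = refl
    lookup-init {suc b} (y ∷ ys) (F.suc k) = lookup-init ys k

  at-ρ : ∀ {a} (s : Word q (suc a)) x → at (ρ s) (suc x) ≡ at s x
  at-ρ {a} s x = trans (lookup-ρ s (suc x mod suc a)) (at-cong s (toℕ (suc x mod suc a) + a) x (begin
      (toℕ (suc x mod suc a) + a) % suc a  ≡⟨ cong (λ z → (z + a) % suc a) (FP.toℕ-fromℕ< (m%n<n (suc x) (suc a))) ⟩
      (suc x % suc a + a) % suc a          ≡⟨ [m%n+c]%n≡[m+c]%n (suc x) a (suc a) ⟩
      (suc x + a) % suc a                  ≡⟨ cong (_% suc a) (sym (+-suc x a)) ⟩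
      (x + suc a) % suc a                  ≡⟨ [m+n]%n≡m%n x (suc a) ⟩
      x % suc a                            ∎))
    where open ≡-Reasoning

  at-ρ^ : ∀ {a} (s : Word q (suc a)) j x → at (ρ^ j s) (x + j) ≡ at s x
  at-ρ^ s zero x = cong (at s) (+-identityʳ x)
  at-ρ^ s (suc j) x = begin
    at (ρ (ρ^ j s)) (x + suc j)  ≡⟨ cong (at (ρ (ρ^ j s))) (+-suc x j) ⟩
    at (ρ (ρ^ j s)) (suc (x + j)) ≡⟨ at-ρ (ρ^ j s) (x + j) ⟩
    at (ρ^ j s) (x + j)          ≡⟨ at-ρ^ s j x ⟩
    at s x                       ∎
    where open ≡-Reasoning

  -- Equivalently, ρ^j s reads s shifted back by j, i.e. forward by a·j (mod a + 1).
  at-ρ^-shift : ∀ {a} (s : Word q (suc a)) j y → at (ρ^ j s) y ≡ at s (y + a * j)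
  at-ρ^-shift {a} s j y = trans (at-cong (ρ^ j s) y (y + a * j + j) y≡) (at-ρ^ s j (y + a * j))
    where
    y≡ : y % suc a ≡ (y + a * j + j) % suc a
    y≡ = trans (sym ([m+kn]%n≡m%n y j (suc a)))
               (cong (_% suc a) (solve 3 (λ y a j → y :+ j :* (con 1 :+ a) := y :+ a :* j :+ j) refl y a j))

  Periodic : ∀ {a} → Word q (suc a) → ℕ → Set
  Periodic s p = ∀ x → at s (x + p) ≡ at s x

  periodic-length : ∀ {a} (s : Word q (suc a)) → Periodic s (suc a)
  periodic-length {a} s x = at-cong s (x + suc a) x ([m+n]%n≡m%n x (suc a))

  periodic-* : ∀ {a} (s : Word q (suc a)) {p} → Periodic s p → ∀ c → Periodic s (c * p)
  periodic-* s per zero x = cong (at s) (+-identityʳ x)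
  periodic-* s {p} per (suc c) x =
    trans (cong (at s) (sym (+-assoc x p (c * p)))) (trans (periodic-* s per c (x + p)) (per x))

  periodic-cancel : ∀ {a} (s : Word q (suc a)) g b → Periodic s (g + b) → Periodic s b → Periodic s g
  periodic-cancel s g b per-gb per-b x =
    trans (sym (per-b (x + g))) (trans (cong (at s) (+-assoc x g b)) (per-gb x))

  -- By Bézout, the periods form a subgroup: the gcd of a period with the length is a period.
  periodic-gcd : ∀ {a} (s : Word q (suc a)) p → Periodic s p → Periodic s (gcd p (suc a))
  periodic-gcd {a} s p per with Bézout.identity (gcd-GCD p (suc a))
  ... | Bézout.+- x y eq = periodic-cancel s _ (y * suc a)
          (subst (Periodic s) (sym eq) (periodic-* s per x)) (periodic-* s (periodic-length s) y)
  ... | Bézout.-+ x y eq = periodic-cancel s _ (x * p)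
          (subst (Periodic s) (sym eq) (periodic-* s (periodic-length s) y)) (periodic-* s per x)

  rotation⇒periodic : ∀ {a} (s : Word q (suc a)) j → ρ^ j s ≡ s → Periodic s j
  rotation⇒periodic s j fixed x = trans (cong (λ z → at z (x + j)) (sym fixed)) (at-ρ^ s j x)

  periodic⇒rotation : ∀ {a} (s : Word q (suc a)) j → Periodic s j → ρ^ j s ≡ s
  periodic⇒rotation {a} s j per = word-ext (ρ^ j s) s (λ y → trans (at-ρ^-shift s j y) (periodic-* s per a y))

max-upper : (f : ℕ → ℕ) (xs : List ℕ) {x : ℕ} → x ∈ xs → f x ≤ foldr _⊔_ 0 (map f xs)
max-upper f (y ∷ xs) (here refl) = m≤m⊔n (f y) _
max-upper f (y ∷ xs) (there x∈xs) = ≤-trans (max-upper f xs x∈xs) (m≤n⊔m (f y) _)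

max-attained : (f : ℕ → ℕ) (xs : List ℕ) {c : ℕ} → foldr _⊔_ 0 (map f xs) ≡ suc c →
               Σ ℕ λ x → x ∈ xs × f x ≡ suc c
max-attained f (y ∷ xs) h with ⊔-sel (f y) (foldr _⊔_ 0 (map f xs))
... | inj₁ max≡fy = y , here refl , trans (sym max≡fy) h
... | inj₂ max≡rest with max-attained f xs (trans (sym max≡rest) h)
...   | x , x∈xs , fx = x , there x∈xs , fx

module _ {q : ℕ} {a : ℕ} where

  OrderTest : Word q (suc a) → ℕ → Bool
  OrderTest s e = divides? (suc e) (suc a) ∧ eqW (ρ^ (suc a / suc e) s) s

  order-≥-test : (s : Word q (suc a)) (e : ℕ) → e < suc a → OrderTest s e ≡ true → suc e ≤ order s
  order-≥-test s e e<n passes with (_ ≤ order s) ∋ max-upper _ (upTo (suc a)) (∈-upTo⁺ e<n)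
  ... | bound with OrderTest s e
  ... | true = bound

  order-test : (s : Word q (suc a)) (c : ℕ) → order s ≡ suc c → OrderTest s c ≡ true
  order-test s c ord with max-attained _ (upTo (suc a)) ord
  ... | x , _ , fx with OrderTest s x in passes
  ... | true with suc-injective fx
  ...   | refl = passes

  order-≥ : (s : Word q (suc a)) (d p : ℕ) → d * p ≡ suc a → Periodic s p → d ≤ order s
  order-≥ s (suc e) p dp≡n per = order-≥-test s e (∣⇒≤ e+1∣n) (∧-intro divides-test rotation)
    where
    e+1∣n : suc e ∣ suc a
    e+1∣n = divides p (trans (sym dp≡n) (*-comm (suc e) p))
    n/[e+1]≡p : suc a / suc e ≡ p
    n/[e+1]≡p = trans (cong (_/ suc e) (trans (sym dp≡n) (*-comm (suc e) p))) (m*n/n≡m p (suc e))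
    divides-test : divides? (suc e) (suc a) ≡ true
    divides-test = cong (_≡ᵇ 0) (n∣m⇒m%n≡0 (suc a) (suc e) e+1∣n)
    rotation : eqW (ρ^ (suc a / suc e) s) s ≡ true
    rotation = subst (λ z → eqW z s ≡ true) (sym (trans (cong (λ j → ρ^ j s) n/[e+1]≡p) (periodic⇒rotation s p per))) (eqW-refl s)

  order-pos : (s : Word q (suc a)) → 1 ≤ order s
  order-pos s = order-≥ s 1 (suc a) (+-identityʳ (suc a)) (periodic-length s)

  order-attained : (s : Word q (suc a)) → Σ ℕ λ p → order s * p ≡ suc a × Periodic s p
  order-attained s with order s in ord | order-pos s
  ... | suc c | _ = suc a / suc c , m*[n/m]≡n c+1∣n , rotation⇒periodic s _ (eqW-sound _ s (∧-elimʳ passes))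
    where
    passes : OrderTest s c ≡ true
    passes = order-test s c ord
    c+1∣n : suc c ∣ suc a
    c+1∣n = m%n≡0⇒n∣m (suc a) (suc c) (≡ᵇ-sound (∧-elimˡ passes))

  primitive-period : (u : Word q (suc a)) → order u ≡ 1 → (p : ℕ) → Periodic u p → suc a ∣ p
  primitive-period u ord p per = subst (_∣ p) (sym n≡g) (gcd[m,n]∣m p (suc a))
    where
    g : ℕ
    g = gcd p (suc a)
    open _∣_ (gcd[m,n]∣n p (suc a)) renaming (quotient to E; equality to n≡Eg)
    E≤1 : E ≤ 1
    E≤1 = subst (E ≤_) ord (order-≥ u E g (sym n≡Eg) (periodic-gcd u p per))
    n≡g : suc a ≡ g
    n≡g with E | E≤1 | n≡Eg
    ... | 1 | _ | n≡1g = trans n≡1g (+-identityʳ g)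
    ... | 0 | _ | ()
    ... | suc (suc _) | s≤s () | _

toℕ-reduce≥ : ∀ {m n} (i : Fin (m + n)) .(m≤i : m ≤ toℕ i) → toℕ (F.reduce≥ i m≤i) ≡ toℕ i ∸ m
toℕ-reduce≥ {zero} i _ = refl
toℕ-reduce≥ {suc m} (F.suc i) m≤i = toℕ-reduce≥ {m} i (s≤s⁻¹ m≤i)

module _ {q : ℕ} {n : ℕ} where

  at-++ˡ : ∀ {r} (u : Word q (suc n)) (v : Word q r) y → y < suc n → at (u ++ v) y ≡ at u y
  at-++ˡ {r} u v y y<n = trans (VP.lookup-++-< u v (y mod (suc n + r)) i<n)
    (cong (lookup u) (FP.toℕ-injective (trans (FP.toℕ-fromℕ< i<n) (trans toℕ-i (sym toℕ-j)))))
    where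
    toℕ-i : toℕ (y mod (suc n + r)) ≡ y
    toℕ-i = trans (FP.toℕ-fromℕ< (m%n<n y (suc n + r))) (m<n⇒m%n≡m (≤-trans y<n (m≤m+n (suc n) r)))
    toℕ-j : toℕ (y mod suc n) ≡ y
    toℕ-j = trans (FP.toℕ-fromℕ< (m%n<n y (suc n))) (m<n⇒m%n≡m y<n)
    i<n : toℕ (y mod (suc n + r)) < suc n
    i<n = subst (_< suc n) (sym toℕ-i) y<n

  periodic-agree : ∀ {a} (s : Word q (suc a)) (u : Word q (suc n)) → Periodic s (suc n) →
                   (∀ y → y < suc n → at s y ≡ at u y) → ∀ x → at s x ≡ at u x
  periodic-agree s u per agree x = begin
    at s x                                 ≡⟨ cong (at s) (m≡m%n+[m/n]*n x (suc n)) ⟩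
    at s (x % suc n + x / suc n * suc n)   ≡⟨ periodic-* s per (x / suc n) (x % suc n) ⟩
    at s (x % suc n)                       ≡⟨ agree (x % suc n) (m%n<n x (suc n)) ⟩
    at u (x % suc n)                       ≡⟨ at-cong u (x % suc n) x (m%n%n≡m%n x (suc n)) ⟩
    at u x                                 ∎
    where open ≡-Reasoning

module Repetition {q : ℕ} {n : ℕ} (d : ℕ) where

  rep-tail : Word q (suc n) → Word q (d * suc n)
  rep-tail u = tabulate (λ i → at u (suc n + toℕ i))

  rep : Word q (suc n) → Word q (suc d * suc n)
  rep u = u ++ rep-tail u

  at-rep : (u : Word q (suc n)) (x : ℕ) → at (rep u) x ≡ at u x
  at-rep u x = begin
    at (rep u) x        ≡⟨ at-cong (rep u) x (x % N) (sym (m%n%n≡m%n x N)) ⟩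
    at (rep u) (x % N)  ≡⟨ within (x % N) (m%n<n x N) ⟩
    at u (x % N)        ≡⟨ at-cong u (x % N) x (m∣n⇒o%n%m≡o%m (suc n) N x (divides (suc d) refl)) ⟩
    at u x              ∎
    where
    open ≡-Reasoning
    N : ℕ
    N = suc d * suc n
    within : ∀ y → y < N → at (rep u) y ≡ at u y
    within y y<N with y <? suc n
    ... | yes y<n = at-++ˡ u (rep-tail u) y y<n
    ... | no y≮n = begin
      lookup (u ++ rep-tail u) (y mod N)   ≡⟨ VP.lookup-++-≥ u (rep-tail u) (y mod N) n≤i ⟩
      lookup (rep-tail u) (F.reduce≥ (y mod N) n≤i) ≡⟨ VP.lookup∘tabulate _ (F.reduce≥ (y mod N) n≤i) ⟩
      at u (suc n + toℕ (F.reduce≥ (y mod N) n≤i)) ≡⟨ cong (λ z → at u (suc n + z)) (trans (toℕ-reduce≥ {suc n} (y mod N) n≤i) (cong (_∸ suc n) toℕ-i)) ⟩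
      at u (suc n + (y ∸ suc n))           ≡⟨ cong (at u) (m+[n∸m]≡n (≮⇒≥ y≮n)) ⟩
      at u y                               ∎
      where
      toℕ-i : toℕ (y mod N) ≡ y
      toℕ-i = trans (FP.toℕ-fromℕ< (m%n<n y N)) (m<n⇒m%n≡m y<N)
      n≤i : suc n ≤ toℕ (y mod N)
      n≤i = subst (suc n ≤_) (sym toℕ-i) (≮⇒≥ y≮n)

  periodic-rep⁺ : (u : Word q (suc n)) {p : ℕ} → Periodic u p → Periodic (rep u) p
  periodic-rep⁺ u {p} per x = trans (at-rep u (x + p)) (trans (per x) (sym (at-rep u x)))

  periodic-rep⁻ : (u : Word q (suc n)) {p : ℕ} → Periodic (rep u) p → Periodic u p
  periodic-rep⁻ u {p} per x = trans (sym (at-rep u (x + p))) (trans (per x) (at-rep u x))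

  rep-tail-unique : (u : Word q (suc n)) (v : Word q (d * suc n)) → Periodic (u ++ v) (suc n) → v ≡ rep-tail u
  rep-tail-unique u v per = VP.++-injectiveʳ u u (word-ext (u ++ v) (rep u) (λ x →
    trans (periodic-agree (u ++ v) u per (at-++ˡ u v) x) (sym (at-rep u x))))

  -- The repetition of a word of order 1 has order d + 1: its order c satisfies c·p = |uᴰ|
  -- for a period p, which is a multiple t·(n+1) of |u|, so c·t = d + 1.
  order-rep-primitive : (u : Word q (suc n)) → order u ≡ 1 → order (rep u) ≡ suc d
  order-rep-primitive u ord = ≤-antisym upper lower
    where
    lower : suc d ≤ order (rep u)
    lower = order-≥ (rep u) (suc d) (suc n) refl (periodic-rep⁺ u (periodic-length u))
    upper : order (rep u) ≤ suc d
    upper with order-attained (rep u)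
    ... | p , cp≡N , per with primitive-period u ord p (periodic-rep⁻ u per)
    ...   | divides t p≡tn = ∣⇒≤ (divides t (trans (sym ct≡d+1) (*-comm c t)))
      where
      open ≡-Reasoning
      c : ℕ
      c = order (rep u)
      ct≡d+1 : c * t ≡ suc d
      ct≡d+1 = *-cancelʳ-≡ (c * t) (suc d) (suc n) (begin
        c * t * suc n    ≡⟨ *-assoc c t (suc n) ⟩
        c * (t * suc n)  ≡⟨ cong (c *_) p≡tn ⟨
        c * p            ≡⟨ cp≡N ⟩
        suc d * suc n    ∎)

  -- Conversely, if uᴰ has order d + 1 then u has order 1: for c = order u with period p,
  -- (d+1)·c · p = |uᴰ| with p a period of uᴰ, so (d+1)·c ≤ d + 1.
  order-rep-primitive⁻¹ : (u : Word q (suc n)) → order (rep u) ≡ suc d → order u ≡ 1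
  order-rep-primitive⁻¹ u ord with order-attained u
  ... | p , cp≡n , per = ≤-antisym (*-cancelˡ-≤ (suc d) bound) (order-pos u)
    where
    bound : suc d * order u ≤ suc d * 1
    bound = subst (suc d * order u ≤_) (trans ord (sym (*-identityʳ (suc d))))
      (order-≥ (rep u) (suc d * order u) p (trans (*-assoc (suc d) (order u) p) (cong (suc d *_) cp≡n)) (periodic-rep⁺ u per))

  order-rep : (u : Word q (suc n)) → (order (rep u) ≡ᵇ suc d) ≡ (order u ≡ᵇ 1)
  order-rep u = ≡ᵇ-cong-iff (order-rep-primitive⁻¹ u) (order-rep-primitive u)

  window-rep : ∀ k (u : Word q (suc n)) i → window k (rep u) i ≡ window k u i
  window-rep k u i = VP.tabulate-cong (λ j → at-rep u (i + toℕ j))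

  window-periodic : ∀ k (u : Word q (suc n)) i → window k u (suc n + i) ≡ window k u i
  window-periodic k u i = VP.tabulate-cong (λ j →
    trans (cong (at u) (trans (+-assoc (suc n) i (toℕ j)) (+-comm (suc n) (i + toℕ j)))) (periodic-length u (i + toℕ j)))

  occ-rep : ∀ {k} (u : Word q (suc n)) (y : Word q k) → occ (rep u) y ≡ suc d * occ u y
  occ-rep {k} u y = begin
    count (λ i → eqW (window k (rep u) i) y) (upTo (suc d * suc n))
      ≡⟨ count-cong (λ i → cong (λ w → eqW w y) (window-rep k u i)) (upTo (suc d * suc n)) ⟩
    count occurs-at (upTo (suc d * suc n))
      ≡⟨ count-periodic occurs-at (suc n) (λ i → cong (λ w → eqW w y) (window-periodic k u i)) (suc d) ⟩
    suc d * occ u y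
      ∎
    where
    open ≡-Reasoning
    occurs-at : ℕ → Bool
    occurs-at i = eqW (window k u i) y

  isMDB-rep : ∀ m m' k → m ≡ suc d * m' → (u : Word q (suc n)) → isMDB m k (rep u) ≡ isMDB m' k u
  isMDB-rep m m' k m≡ u = allᵇ-cong (λ y → trans (cong₂ _≡ᵇ_ (occ-rep u y) m≡)
    (≡ᵇ-cong-iff (*-cancelˡ-≡ (occ u y) m' (suc d)) (cong (suc d *_)))) (allWords q k)

  startsWith-rep : ∀ {k} (y : Word q k) (u : Word q (suc n)) → startsWith (rep u) y ≡ startsWith u y
  startsWith-rep {k} y u = cong (λ w → eqW w y) (window-rep k u 0)

  ρ^-rep : ∀ i (u : Word q (suc n)) → ρ^ i (rep u) ≡ rep (ρ^ i u)
  ρ^-rep i u = word-ext (ρ^ i (rep u)) (rep (ρ^ i u)) λ y → begin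
    at (ρ^ i (rep u)) y              ≡⟨ at-ρ^-shift (rep u) i y ⟩
    at (rep u) (y + (n + d * suc n) * i) ≡⟨ at-rep u (y + (n + d * suc n) * i) ⟩
    at u (y + (n + d * suc n) * i)   ≡⟨ at-cong u (y + (n + d * suc n) * i) (y + n * i) (shift y) ⟩
    at u (y + n * i)                 ≡⟨ at-ρ^-shift u i y ⟨
    at (ρ^ i u) y                    ≡⟨ at-rep (ρ^ i u) y ⟨
    at (rep (ρ^ i u)) y              ∎
    where
    open ≡-Reasoning
    shift : ∀ y → (y + (n + d * suc n) * i) % suc n ≡ (y + n * i) % suc n
    shift y = trans (cong (_% suc n) (solve 4 (λ y n d i → y :+ (n :+ d :* (con 1 :+ n)) :* i := y :+ n :* i :+ (d :* i) :* (con 1 :+ n)) refl y n d i))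
                  ([m+kn]%n≡m%n (y + n * i) (d * i) (suc n))

  canonical-rep : (u : Word q (suc n)) → isCanonical (rep u) ≡ isCanonical u
  canonical-rep u = begin
    allᵇ (λ i → lexLeq (rep u) (ρ^ i (rep u))) (upTo (suc d * suc n))
      ≡⟨ allᵇ-cong (λ i → trans (cong (lexLeq (rep u)) (ρ^-rep i u)) (lexLeq-++ u (ρ^ i u) _ _ (cong rep-tail))) (upTo (suc d * suc n)) ⟩
    allᵇ minimal-against (upTo (suc d * suc n))
      ≡⟨ all-periodic minimal-against (suc n) (λ i → cong (lexLeq u) rotation-periodic) d ⟩
    isCanonical u
      ∎
    where
    open ≡-Reasoning
    minimal-against : ℕ → Bool
    minimal-against i = lexLeq u (ρ^ i u)
    rotation-periodic : ∀ {i} → ρ^ (suc n + i) u ≡ ρ^ i u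
    rotation-periodic {i} = trans (ρ^-+ (suc n) i u) (periodic⇒rotation (ρ^ i u) (suc n) (periodic-length (ρ^ i u)))

  order-period : (s : Word q (suc d * suc n)) → order s ≡ suc d → Periodic s (suc n)
  order-period s ord with order-attained s
  ... | p , cp≡N , per = subst (Periodic s) (*-cancelˡ-≡ p (suc n) (suc d) (trans (cong (_* p) (sym ord)) cp≡N)) per

  -- Repetition is a bijection between the words of length n+1 with multiplicity m' and
  -- order 1 and the words of length (d+1)(n+1) with multiplicity (d+1)m' and order d+1;
  -- any test X invariant under repetition is carried along.
  count-rep : ∀ m m' k → m ≡ suc d * m' → (X : ∀ {l} → Word q l → Bool) → (∀ u → X (rep u) ≡ X u) →
    count (λ s → (isMDB m k s ∧ (order s ≡ᵇ suc d)) ∧ X s) (allWords q (suc d * suc n))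
      ≡ count (λ u → (isMDB m' k u ∧ (order u ≡ᵇ 1)) ∧ X u) (allWords q (suc n))
  count-rep m m' k m≡ X X-rep = begin
    count F (allWords q (suc n + d * suc n))
      ≡⟨ count-allWords-++ (suc n) (d * suc n) F ⟩
    sumBy (λ u → count (λ v → F (u ++ v)) (allWords q (d * suc n))) (allWords q (suc n))
      ≡⟨ sumBy-cong (λ u → count-unique (d * suc n) (λ v → F (u ++ v)) (rep-tail u) (only-rep-tail u)) (allWords q (suc n)) ⟩
    sumBy (λ u → indicator (F (rep u))) (allWords q (suc n))
      ≡⟨ sumBy-cong (λ u → cong indicator (F-rep u)) (allWords q (suc n)) ⟩
    sumBy (λ u → indicator (G u)) (allWords q (suc n))
      ≡⟨ count≡sumBy G (allWords q (suc n)) ⟨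
    count G (allWords q (suc n))
      ∎
    where
    open ≡-Reasoning
    F : Word q (suc d * suc n) → Bool
    F s = (isMDB m k s ∧ (order s ≡ᵇ suc d)) ∧ X s
    G : Word q (suc n) → Bool
    G u = (isMDB m' k u ∧ (order u ≡ᵇ 1)) ∧ X u
    only-rep-tail : ∀ u v → F (u ++ v) ≡ true → v ≡ rep-tail u
    only-rep-tail u v Fuv = rep-tail-unique u v (order-period (u ++ v) (≡ᵇ-sound (∧-elimʳ {isMDB m k (u ++ v)} (∧-elimˡ Fuv))))
    F-rep : ∀ u → F (rep u) ≡ G u
    F-rep u = cong₂ _∧_ (cong₂ _∧_ (isMDB-rep m m' k m≡ u) (order-rep u)) (X-rep u)

count-allWords-cast : ∀ {q A B} (P : ∀ {l} → Word q l → Bool) → A ≡ B → count P (allWords q A) ≡ count P (allWords q B)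
count-allWords-cast P refl = refl

transfer : ∀ {q} d m' k .{{_ : NonZero m'}} .{{_ : NonZero q}} (X : ∀ {l} → Word q l → Bool) →
  (∀ {n} (u : Word q (suc n)) → X (Repetition.rep d u) ≡ X u) →
  count (λ s → inLC (suc d) (suc d * m') k s ∧ X s) (allWords q (len (suc d * m') q k))
    ≡ count (λ u → inLC 1 m' k u ∧ X u) (allWords q (len m' q k))
transfer {q} d m' k X X-rep = begin
  count F (allWords q (len (suc d * m') q k))  ≡⟨ count-allWords-cast F (trans (*-assoc (suc d) m' (q ^ k)) (cong (suc d *_) (sym n+1≡))) ⟩
  count F (allWords q (suc d * suc n))         ≡⟨ Repetition.count-rep d (suc d * m') m' k refl X X-rep ⟩
  count G (allWords q (suc n))                 ≡⟨ count-allWords-cast G n+1≡ ⟩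
  count G (allWords q (len m' q k))            ∎
  where
  open ≡-Reasoning
  n : ℕ
  n = pred (m' * q ^ k)
  n+1≡ : suc n ≡ m' * q ^ k
  n+1≡ = suc-pred (m' * q ^ k) {{m*n≢0 m' (q ^ k) {{it}} {{m^n≢0 q k}}}}
  F G : ∀ {l} → Word q l → Bool
  F s = (isMDB (suc d * m') k s ∧ (order s ≡ᵇ suc d)) ∧ X s
  G u = (isMDB m' k u ∧ (order u ≡ᵇ 1)) ∧ X u

-- m(d+1) / (d+1) = m, with the divisor visibly nonzero.
quotient : ∀ m d → m * suc d / suc d ≡ m
quotient m d = m*n/n≡m m (suc d)

lemma1 : (m q k d : ℕ) → .{{_ : NonZero m}} → .{{_ : NonZero q}} → .{{_ : NonZero k}}
    → .{{_ : NonZero d}} → d ∣ m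
    → (#LC d m q k ≡ #LC 1 (m / d) q k)
    × ((y : Word q k) → #LCy d m q k y ≡ #LCy 1 (m / d) q k y)
    × (#C d m q k ≡ #C 1 (m / d) q k)
lemma1 .(m' * suc d) q k (suc d) (divides-refl m') rewrite quotient m' d | *-comm m' (suc d) =
    trans (count-cong (λ _ → sym (∧-identityʳ _)) (allWords q (len (suc d * m') q k)))
      (trans (transfer d m' k {{m*n≢0⇒n≢0 (suc d)}} (λ _ → true) (λ _ → refl)) (count-cong (λ _ → ∧-identityʳ _) (allWords q (len m' q k))))
  , (λ y → transfer d m' k {{m*n≢0⇒n≢0 (suc d)}} (λ s → startsWith s y) (Repetition.startsWith-rep d y))
  , transfer d m' k {{m*n≢0⇒n≢0 (suc d)}} isCanonical (Repetition.canonical-rep d)
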